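{- Let $\Sigma$ be a signed graph with $n$ vertices, and let $\mu$ be an eigenvalue of $\Sigma$ with multiplicity $k$. If $\mu\notin\{0,1,-1\}$, then $$n\le \binom{t+2}{3},$$ where $t=n-k$.
   Context: A signed graph $\Sigma=(G,\sigma)$ consists of a simple graph $G$ and a sign function $\sigma$ assigning $\pm1$ to each edge. Its adjacency matrix is obtained from that of $G$ by replacing the entries $1$ corresponding to negative edges by $-1$; the eigenvalues of $\Sigma$ (and their multiplicities) are those of this symmetric matrix. -}

module Defs where

open import Level using (Level; _⊔_) renaming (suc to lsuc)
open import Data.Nat using (ℕ; zero; suc) renaming (_≤_ to _≤ℕ_)
open import Data.Fin using (Fin; zero; suc)
open import Data.Product using (Σ; ∃; _×_; _,_)
open import Relation.Nullary using (¬_)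
open import Relation.Binary.PropositionalEquality using (_≡_)
open import Relation.Binary.Core using (Rel)
open import Relation.Binary.Structures using (IsTotalOrder)
open import Algebra.Bundles using (CommutativeRing)

data EdgeSign : Set where
  absent   : EdgeSign
  positive : EdgeSign
  negative : EdgeSign

record SignedGraph (n : ℕ) : Set where
  field
    edge      : Fin n → Fin n → EdgeSign
    symmetric : ∀ i j → edge i j ≡ edge j i
    loopless  : ∀ i → edge i i ≡ absent

-- Ordered fields (standard axioms); the reals are the intended model.

record OrderedField c ℓ₁ ℓ₂ : Set (lsuc (c ⊔ ℓ₁ ⊔ ℓ₂)) where
  field
    commutativeRing : CommutativeRing c ℓ₁
  open CommutativeRing commutativeRing public
  field
    _≤_          : Rel Carrier ℓ₂
    isTotalOrder : IsTotalOrder _≈_ _≤_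
    +-monoʳ-≤    : ∀ {x y} z → x ≤ y → (x + z) ≤ (y + z)
    *-nonneg     : ∀ {x y} → 0# ≤ x → 0# ≤ y → 0# ≤ (x * y)
    0≉1          : ¬ (0# ≈ 1#)
    inverse      : ∀ x → ¬ (x ≈ 0#) → Σ Carrier (λ y → (x * y) ≈ 1#)

module LinearAlgebra {c ℓ₁ ℓ₂} (F : OrderedField c ℓ₁ ℓ₂) where
  open OrderedField F public using (Carrier; _≈_; _+_; _*_; -_; 0#; 1#)

  Vector : ℕ → Set c
  Vector n = Fin n → Carrier

  Matrix : ℕ → Set c
  Matrix n = Fin n → Fin n → Carrier

  ∑ : ∀ {n} → (Fin n → Carrier) → Carrier
  ∑ {zero}  f = 0#
  ∑ {suc n} f = f zero + ∑ (λ i → f (suc i))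

  _·_ : ∀ {n} → Matrix n → Vector n → Vector n
  (A · x) i = ∑ (λ j → A i j * x j)

  InEigenspace : ∀ {n} → Matrix n → Carrier → Vector n → Set ℓ₁
  InEigenspace A μ x = ∀ i → (A · x) i ≈ (μ * x i)

  LinearlyIndependent : ∀ {n k} → (Fin k → Vector n) → Set (c ⊔ ℓ₁)
  LinearlyIndependent {n} {k} v =
    (a : Fin k → Carrier) →
    (∀ i → ∑ (λ j → a j * v j i) ≈ 0#) →
    ∀ j → a j ≈ 0#

  EigenspaceDim : ∀ {n} → Matrix n → Carrier → ℕ → Set (c ⊔ ℓ₁)
  EigenspaceDim {n} A μ k =
    (Σ (Fin k → Vector n) λ v →
       LinearlyIndependent v × (∀ j → InEigenspace A μ (v j)))
    × ((w : Fin (suc k) → Vector n) →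
         (∀ j → InEigenspace A μ (w j)) → ¬ LinearlyIndependent w)

  signValue : EdgeSign → Carrier
  signValue absent   = 0#
  signValue positive = 1#
  signValue negative = - 1#

  adjacency : ∀ {n} → SignedGraph n → Matrix n
  adjacency Σg i j = signValue (SignedGraph.edge Σg i j)

  -- μ is an eigenvalue of Σ with multiplicity k
  -- (A is symmetric, so geometric = algebraic multiplicity)
  IsEigenvalueWithMultiplicity : ∀ {n} → SignedGraph n → Carrier → ℕ → Set (c ⊔ ℓ₁)
  IsEigenvalueWithMultiplicity Σg μ k = (1 ≤ℕ k) × EigenspaceDim (adjacency Σg) μ k

module Submission where

open import Defs
open import Level using (Level)
open import Data.Nat using (ℕ; suc; _≤_; _∸_)
open import Data.Nat.Combinatorics using (_C_)
open import Relation.Nullary using (¬_)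

open import Level using (_⊔_)
open import Relation.Nullary using (yes; no)
open import Data.Nat using (zero)
import Data.Nat as ℕ
import Data.Nat.Properties as ℕP
open import Data.Nat.Combinatorics using (nCn≡1; nCk+nC[k+1]≡[n+1]C[k+1])
open import Data.Bool using (if_then_else_)
open import Data.Fin using (Fin; zero; suc; punchIn; punchOut; _↑ˡ_; _↑ʳ_)
import Data.Fin as Fin
open import Data.Fin.Properties using (punchInᵢ≢i; punchIn-injective; punchIn-punchOut)
open import Data.Vec.Functional using (_∷_; _++_)
open import Data.Vec.Functional.Properties using (lookup-++ˡ; lookup-++ʳ)
open import Data.Product using (Σ; _,_; proj₁; proj₂)
open import Function using (_∘_)
open import Relation.Binary.PropositionalEquality using (_≡_; _≢_)
import Relation.Binary.PropositionalEquality as ≡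
open import Relation.Nullary.Decidable using (does; dec-true; dec-false; decidable-stable)
open import Relation.Nullary.Negation using (¬¬-map)
open import Data.Sum using (_⊎_; inj₁; inj₂)

-- Write G = μI - A and m = n - k.
-- 1. Constructive rank-nullity (SpanQuotient): for k independent vectors in
--    F^n there is a linear map P : F^n → F^m with a section S whose kernel
--    lies in their span.  It is built one vector at a time by projecting
--    along a vector with a nonzero entry, so it only exists not-not.
-- 2. Gram factorisation: G is symmetric and kills ker P (the eigenvectors
--    lie in ker G), so G w u = B(x_w, x_u) for the columns x_w of P and the
--    bilinear form B of the m×m matrix M = Sᵀ G S.
-- 3. For every vertex w the cubic form f_w(z) = B(x_w, z)(μ B(x_w, z)² - B(z, z))
--    satisfies f_w(x_u) = g (μ g² - μ) with g = G w u.  Off the diagonal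
--    g ∈ {0, ±1}, so g³ = g and f_w(x_u) = 0; on it f_u(x_u) = μ(μ³ - μ) ≠ 0.
-- 4. Polynomials separated by points have independent coefficient vectors,
--    so, by (1) once more, n is at most the number C(m + 2, 3) of cubic
--    monomials in m variables.  The goal is decidable, so the not-not of (1)
--    can be discharged.

monomials : ℕ → ℕ → ℕ
monomials zero    t       = 1
monomials (suc d) zero    = 0
monomials (suc d) (suc t) = monomials (suc d) t ℕ.+ monomials d (suc t)

monomials-count : ∀ d t → monomials d (suc t) ≡ (t ℕ.+ d) C d
monomials-count zero    t       = ≡.refl
monomials-count (suc d) zero    = ≡.trans (monomials-count d zero) (≡.trans (nCn≡1 d) (≡.sym (nCn≡1 (suc d))))
monomials-count (suc d) (suc t) = begin
  monomials (suc d) (suc t) ℕ.+ monomials d (suc (suc t))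
    ≡⟨ ≡.cong₂ ℕ._+_ (monomials-count (suc d) t) (monomials-count d (suc t)) ⟩
  n C suc d ℕ.+ suc (t ℕ.+ d) C d
    ≡⟨ ≡.cong (λ n′ → n C suc d ℕ.+ n′ C d) (≡.sym (ℕP.+-suc t d)) ⟩
  n C suc d ℕ.+ n C d
    ≡⟨ ℕP.+-comm (n C suc d) (n C d) ⟩
  n C d ℕ.+ n C suc d
    ≡⟨ nCk+nC[k+1]≡[n+1]C[k+1] n d ⟩
  suc n C suc d ∎
  where
  open ≡.≡-Reasoning
  n = t ℕ.+ suc d

cubic-monomials : ∀ m → monomials 3 m ≡ suc (suc m) C 3
cubic-monomials zero    = ≡.refl
cubic-monomials (suc t) = ≡.trans (monomials-count 3 t) (≡.cong (_C 3) (ℕP.+-comm t 3))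

module _ {c ℓ₁ ℓ₂} (F : OrderedField c ℓ₁ ℓ₂) where
  open OrderedField F hiding (_≤_; zero)
  open LinearAlgebra F using (Vector; ∑; LinearlyIndependent; InEigenspace; adjacency; signValue)
  open import Algebra.Properties.Semiring.Sum semiring
    using (sum; sum-cong-≋; sum-cong-≗; sum-replicate-zero; sum-remove; ∑-distrib-+; ∑-comm; *-distribˡ-sum; *-distribʳ-sum)
  open import Algebra.Properties.Ring ring
    using ( -1*x≈-x; -‿involutive; -0#≈0#; -‿distribˡ-*; -‿distribʳ-*; [y-z]x≈yx-zx; x[y-z]≈xy-xz
          ; x∙y⁻¹≈ε⇒x≈y; x≈y⇒x∙y⁻¹≈ε)
  open import Algebra.Properties.CommutativeSemigroup *-commutativeSemigroup
    using (x∙yz≈y∙xz; x∙yz≈yx∙z; x∙yz≈xz∙y; xy∙z≈zy∙x; xy∙z≈xz∙y)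
  open import Algebra.Properties.CommutativeSemigroup +-commutativeSemigroup using () renaming (interchange to +-interchange)
  open import Algebra.Solver.Ring.NaturalCoefficients.Default commutativeSemiring using (solve; _:+_; _:*_; _:=_)
  open import Relation.Binary.Reasoning.Setoid setoid

  -- The sum ∑ of Defs is the library's sum; we use the latter so that its
  -- algebraic laws are available.
  ∑≡sum : ∀ {n} (f : Vector n) → ∑ f ≡ sum f
  ∑≡sum {zero}  f = ≡.refl
  ∑≡sum {suc n} f = ≡.cong (f zero +_) (∑≡sum (f ∘ suc))

  sum-zero : ∀ {n} {f : Vector n} → (∀ i → f i ≈ 0#) → sum f ≈ 0#
  sum-zero {n} f≈0 = trans (sum-cong-≋ f≈0) (sum-replicate-zero n)

  sum-neg : ∀ {n} (f : Vector n) → sum (λ i → - f i) ≈ - sum f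
  sum-neg f = begin
    sum (λ i → - f i)       ≈⟨ sum-cong-≋ (λ i → sym (-1*x≈-x (f i))) ⟩
    sum (λ i → - 1# * f i)  ≈⟨ *-distribˡ-sum (- 1#) f ⟨
    - 1# * sum f            ≈⟨ -1*x≈-x (sum f) ⟩
    - sum f                 ∎

  sum-single : ∀ {n} (f : Vector n) i → (∀ j → j ≢ i → f j ≈ 0#) → sum f ≈ f i
  sum-single {suc n} f i off = begin
    sum f                                   ≈⟨ sum-remove f ⟩
    f i + sum (λ j → f (punchIn i j))       ≈⟨ +-congˡ (sum-zero (λ j → off (punchIn i j) (punchInᵢ≢i i j))) ⟩
    f i + 0#                                ≈⟨ +-identityʳ (f i) ⟩
    f i                                     ∎

  sum-sub : ∀ {n} (f g : Vector n) → sum (λ i → f i - g i) ≈ sum f - sum g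
  sum-sub f g = trans (∑-distrib-+ f (λ i → - g i)) (+-congˡ (sum-neg g))

  cancelʳ : ∀ {a K} → ¬ (K ≈ 0#) → a * K ≈ 0# → a ≈ 0#
  cancelʳ {a} {K} K≉0 aK≈0 with inverse K K≉0
  ... | K⁻¹ , KK⁻¹≈1 = begin
    a              ≈⟨ *-identityʳ a ⟨
    a * 1#         ≈⟨ *-congˡ KK⁻¹≈1 ⟨
    a * (K * K⁻¹)  ≈⟨ *-assoc a K K⁻¹ ⟨
    a * K * K⁻¹    ≈⟨ *-congʳ aK≈0 ⟩
    0# * K⁻¹       ≈⟨ zeroˡ K⁻¹ ⟩
    0#             ∎

  *-nonzero : ∀ {x y} → ¬ (x ≈ 0#) → ¬ (y ≈ 0#) → ¬ (x * y ≈ 0#)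
  *-nonzero x≉0 y≉0 xy≈0 = x≉0 (cancelʳ y≉0 xy≈0)

  -1≉0 : ¬ (- 1# ≈ 0#)
  -1≉0 -1≈0 = 0≉1 (sym (trans (sym (-‿involutive 1#)) (trans (-‿cong -1≈0) -0#≈0#)))

  δ : ∀ {n} → Fin n → Fin n → Carrier
  δ i j = if does (i Fin.≟ j) then 1# else 0#

  δ-diag : ∀ {n} (i : Fin n) → δ i i ≡ 1#
  δ-diag i = ≡.cong (if_then 1# else 0#) (dec-true (i Fin.≟ i) ≡.refl)

  δ-off : ∀ {n} {i j : Fin n} → i ≢ j → δ i j ≡ 0#
  δ-off {i = i} {j} i≢j = ≡.cong (if_then 1# else 0#) (dec-false (i Fin.≟ j) i≢j)

  δ-sym : ∀ {n} (i j : Fin n) → δ i j ≡ δ j i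
  δ-sym i j with i Fin.≟ j
  ... | yes ≡.refl = ≡.sym (δ-diag i)
  ... | no i≢j     = ≡.sym (δ-off (i≢j ∘ ≡.sym))

  Mat : ℕ → ℕ → Set c
  Mat m n = Fin m → Fin n → Carrier

  infixr 7 _⊛_
  _⊛_ : ∀ {m n} → Mat m n → Vector n → Vector m
  (M ⊛ x) i = sum (λ j → M i j * x j)

  infixr 8 _⊙_
  _⊙_ : ∀ {m n o} → Mat m n → Mat n o → Mat m o
  (A ⊙ B) i k = sum (λ j → A i j * B j k)

  ⊛-cong : ∀ {m n} (M : Mat m n) {x y : Vector n} → (∀ j → x j ≈ y j) → ∀ i → (M ⊛ x) i ≈ (M ⊛ y) i
  ⊛-cong M x≈y i = sum-cong-≋ (λ j → *-congˡ (x≈y j))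

  ⊛-δ : ∀ {n} (x : Vector n) i → (δ ⊛ x) i ≈ x i
  ⊛-δ x i = trans (sum-single (λ j → δ i j * x j) i off) (trans (*-congʳ (reflexive (δ-diag i))) (*-identityˡ (x i)))
    where
    off : ∀ j → j ≢ i → δ i j * x j ≈ 0#
    off j j≢i = trans (*-congʳ (reflexive (δ-off (j≢i ∘ ≡.sym)))) (zeroˡ (x j))

  scaled-δ : ∀ {n} a (x : Vector n) i → sum (λ u → a * δ i u * x u) ≈ a * x i
  scaled-δ a x i = begin
    sum (λ u → a * δ i u * x u)     ≈⟨ sum-cong-≋ (λ u → *-assoc a (δ i u) (x u)) ⟩
    sum (λ u → a * (δ i u * x u))   ≈⟨ *-distribˡ-sum a (λ u → δ i u * x u) ⟨
    a * (δ ⊛ x) i                   ≈⟨ *-congˡ (⊛-δ x i) ⟩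
    a * x i                         ∎

  ⊛-difference : ∀ {m n} (X Y : Mat m n) x i → ((λ i u → X i u - Y i u) ⊛ x) i ≈ (X ⊛ x) i - (Y ⊛ x) i
  ⊛-difference X Y x i = trans (sum-cong-≋ (λ u → [y-z]x≈yx-zx (x u) (X i u) (Y i u)))
                               (sum-sub (λ u → X i u * x u) (λ u → Y i u * x u))

  ⊛-assoc : ∀ {m n o} (A : Mat m n) (B : Mat n o) x i → ((A ⊙ B) ⊛ x) i ≈ (A ⊛ B ⊛ x) i
  ⊛-assoc A B x i = begin
    sum (λ k → sum (λ j → A i j * B j k) * x k)   ≈⟨ sum-cong-≋ (λ k → *-distribʳ-sum (x k) (λ j → A i j * B j k)) ⟩
    sum (λ k → sum (λ j → A i j * B j k * x k))   ≈⟨ ∑-comm (λ k j → A i j * B j k * x k) ⟩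
    sum (λ j → sum (λ k → A i j * B j k * x k))   ≈⟨ sum-cong-≋ (λ j → sum-cong-≋ (λ k → *-assoc (A i j) (B j k) (x k))) ⟩
    sum (λ j → sum (λ k → A i j * (B j k * x k))) ≈⟨ sum-cong-≋ (λ j → *-distribˡ-sum (A i j) (λ k → B j k * x k)) ⟨
    sum (λ j → A i j * sum (λ k → B j k * x k))   ∎

  ⊛-scale : ∀ {m n} (M : Mat m n) a x i → (M ⊛ (λ u → a * x u)) i ≈ a * (M ⊛ x) i
  ⊛-scale M a x i = begin
    sum (λ u → M i u * (a * x u))  ≈⟨ sum-cong-≋ (λ u → x∙yz≈y∙xz (M i u) a (x u)) ⟩
    sum (λ u → a * (M i u * x u))  ≈⟨ *-distribˡ-sum a (λ u → M i u * x u) ⟨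
    a * (M ⊛ x) i                  ∎

  ⊛-sub : ∀ {m n} (M : Mat m n) x y i → (M ⊛ (λ u → x u - y u)) i ≈ (M ⊛ x) i - (M ⊛ y) i
  ⊛-sub M x y i = begin
    sum (λ u → M i u * (x u - y u))        ≈⟨ sum-cong-≋ (λ u → x[y-z]≈xy-xz (M i u) (x u) (y u)) ⟩
    sum (λ u → M i u * x u - M i u * y u)  ≈⟨ sum-sub (λ u → M i u * x u) (λ u → M i u * y u) ⟩
    (M ⊛ x) i - (M ⊛ y) i                  ∎

  ⊛-combination : ∀ {m n k} (M : Mat m n) (l : Vector k) (v : Fin k → Vector n) i →
                  (M ⊛ (λ u → sum (λ a → l a * v a u))) i ≈ sum (λ a → l a * (M ⊛ v a) i)
  ⊛-combination M l v i = begin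
    sum (λ u → M i u * sum (λ a → l a * v a u))    ≈⟨ sum-cong-≋ (λ u → *-distribˡ-sum (M i u) (λ a → l a * v a u)) ⟩
    sum (λ u → sum (λ a → M i u * (l a * v a u)))  ≈⟨ ∑-comm (λ u a → M i u * (l a * v a u)) ⟩
    sum (λ a → sum (λ u → M i u * (l a * v a u)))  ≈⟨ sum-cong-≋ (λ a → ⊛-scale M (l a) (v a) i) ⟩
    sum (λ a → l a * (M ⊛ v a) i)                  ∎

  InSpan : ∀ {n k} → (Fin k → Vector n) → Vector n → Set (c ⊔ ℓ₁)
  InSpan {k = k} v x = Σ (Vector k) λ l → ∀ u → x u ≈ sum (λ a → l a * v a u)

  Independent : ∀ {n k} → (Fin k → Vector n) → Set (c ⊔ ℓ₁)
  Independent {k = k} v = ∀ (a : Vector k) → (∀ u → sum (λ j → a j * v j u) ≈ 0#) → ∀ j → a j ≈ 0#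

  independent : ∀ {n k} {v : Fin k → Vector n} → LinearlyIndependent v → Independent v
  independent {v = v} li a rel = li a (λ u → ≡.subst (_≈ 0#) (≡.sym (∑≡sum (λ j → a j * v j u))) (rel u))

  independent-tail : ∀ {n k} {v : Fin (suc k) → Vector n} → Independent v → Independent (v ∘ suc)
  independent-tail ind a rel j = ind (0# ∷ a) (λ u → trans (+-cong (zeroˡ _) (rel u)) (+-identityˡ 0#)) (suc j)

  head∉span-tail : ∀ {n k} {v : Fin (suc k) → Vector n} → Independent v → ¬ InSpan (v ∘ suc) (v zero)
  head∉span-tail {v = v} ind (l , v₀≈lv) = -1≉0 (ind (- 1# ∷ l) relation zero)
    where
    relation : ∀ u → - 1# * v zero u + sum (λ a → l a * v (suc a) u) ≈ 0#
    relation u = trans (+-cong (-1*x≈-x (v zero u)) (sym (v₀≈lv u))) (-‿inverseˡ (v zero u))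

  -- Constructively we cannot decide whether a vector vanishes, but it is
  -- not-not the case that it vanishes or has a nonzero entry.
  zero-or-nonzero : ∀ {m} (w : Vector m) → ¬ ¬ ((∀ j → w j ≈ 0#) ⊎ Σ (Fin m) λ p → ¬ w p ≈ 0#)
  zero-or-nonzero {zero}  w k = k (inj₁ λ ())
  zero-or-nonzero {suc m} w k = zero-or-nonzero (w ∘ suc) λ
    { (inj₂ (p , wp≉0)) → k (inj₂ (suc p , wp≉0))
    ; (inj₁ tail≈0)     → k (inj₂ (zero , λ w₀≈0 → k (inj₁ λ { zero → w₀≈0 ; (suc j) → tail≈0 j })))
    }

  a-b+b≈a : ∀ a b → a - b + b ≈ a
  a-b+b≈a a b = trans (+-assoc a (- b) b) (trans (+-congˡ (-‿inverseˡ b)) (+-identityʳ a))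

  -- A concrete model of the quotient F^n / span v: a linear map onto F^m
  -- with a linear section whose kernel lies in span v.  For an independent
  -- family of k vectors such a quotient exists with m + k = n; this is the
  -- constructive content of rank-nullity that the proof needs.
  record SpanQuotient {n k} (v : Fin k → Vector n) (m : ℕ) : Set (c ⊔ ℓ₁) where
    field
      m+k≡n   : m ℕ.+ k ≡ n
      proj    : Mat m n
      section : Mat n m
      retract : ∀ y j → (proj ⊛ section ⊛ y) j ≈ y j
      kernel  : ∀ x → (∀ j → (proj ⊛ x) j ≈ 0#) → InSpan v x

  identity-quotient : ∀ {n} (v : Fin 0 → Vector n) → SpanQuotient v n
  identity-quotient {n} v = record
    { m+k≡n   = ℕP.+-identityʳ n
    ; proj    = δ
    ; section = δ
    ; retract = λ y j → trans (⊛-δ (δ ⊛ y) j) (⊛-δ y j)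
    ; kernel  = λ x x≈0 → (λ ()) , λ u → trans (sym (⊛-δ x u)) (x≈0 u)
    }

  module ProjectAlong {m} (w : Vector (suc m)) (p : Fin (suc m)) (w⁻¹ : Carrier) (wp*w⁻¹≈1 : w p * w⁻¹ ≈ 1#) where

    ratio : Fin m → Carrier
    ratio j = w (punchIn p j) * w⁻¹

    proj : Mat m (suc m)
    proj j u = δ (punchIn p j) u - ratio j * δ p u

    section : Mat (suc m) m
    section u j = δ u (punchIn p j)

    proj-apply : ∀ x j → (proj ⊛ x) j ≈ x (punchIn p j) - ratio j * x p
    proj-apply x j = trans (⊛-difference (λ j u → δ (punchIn p j) u) (λ j u → ratio j * δ p u) x j)
                           (+-cong (⊛-δ x (punchIn p j)) (-‿cong (scaled-δ (ratio j) x p)))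

    section-punchIn : ∀ y j → (section ⊛ y) (punchIn p j) ≈ y j
    section-punchIn y j = trans (sum-single (λ j' → δ (punchIn p j) (punchIn p j') * y j') j off)
                                (trans (*-congʳ (reflexive (δ-diag (punchIn p j)))) (*-identityˡ (y j)))
      where
      off : ∀ j' → j' ≢ j → δ (punchIn p j) (punchIn p j') * y j' ≈ 0#
      off j' j'≢j = trans (*-congʳ (reflexive (δ-off (j'≢j ∘ ≡.sym ∘ punchIn-injective p j j')))) (zeroˡ (y j'))

    section-p : ∀ y → (section ⊛ y) p ≈ 0#
    section-p y = sum-zero (λ j → trans (*-congʳ (reflexive (δ-off (punchInᵢ≢i p j ∘ ≡.sym)))) (zeroˡ (y j)))

    retract : ∀ y j → (proj ⊛ section ⊛ y) j ≈ y j
    retract y j = begin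
      (proj ⊛ section ⊛ y) j                                          ≈⟨ proj-apply (section ⊛ y) j ⟩
      (section ⊛ y) (punchIn p j) - ratio j * (section ⊛ y) p         ≈⟨ +-cong (section-punchIn y j) (-‿cong (*-congˡ (section-p y))) ⟩
      y j - ratio j * 0#                                              ≈⟨ +-congˡ (trans (-‿cong (zeroʳ (ratio j))) -0#≈0#) ⟩
      y j + 0#                                                        ≈⟨ +-identityʳ (y j) ⟩
      y j                                                             ∎

    kernel : ∀ x → (∀ j → (proj ⊛ x) j ≈ 0#) → ∀ u → x u ≈ x p * w⁻¹ * w u
    kernel x Px≈0 u with p Fin.≟ u
    ... | yes ≡.refl = begin
      x p                 ≈⟨ *-identityʳ (x p) ⟨
      x p * 1#            ≈⟨ *-congˡ wp*w⁻¹≈1 ⟨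
      x p * (w p * w⁻¹)   ≈⟨ x∙yz≈xz∙y (x p) (w p) w⁻¹ ⟩
      x p * w⁻¹ * w p     ∎
    ... | no p≢u = ≡.subst (λ u → x u ≈ x p * w⁻¹ * w u) (punchIn-punchOut p≢u) (begin
      x (punchIn p j)     ≈⟨ x∙y⁻¹≈ε⇒x≈y _ _ (trans (sym (proj-apply x j)) (Px≈0 j)) ⟩
      ratio j * x p       ≈⟨ xy∙z≈zy∙x (w (punchIn p j)) w⁻¹ (x p) ⟩
      x p * w⁻¹ * w (punchIn p j) ∎)
      where j = punchOut p≢u

  -- If the first vector v₀ of the family survives in a quotient by the other
  -- vectors, with nonzero entry p, then projecting further along its image
  -- gives a quotient by the whole family, of one dimension less.
  extend-quotient : ∀ {n k m} {v : Fin (suc k) → Vector n} (q : SpanQuotient (v ∘ suc) m) (p : Fin m) →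
                    ¬ (SpanQuotient.proj q ⊛ v zero) p ≈ 0# → SpanQuotient v (ℕ.pred m)
  extend-quotient {n} {k} {suc m} {v} q p wp≉0 = record
    { m+k≡n   = ≡.trans (ℕP.+-suc m k) m+k≡n
    ; proj    = Along.proj ⊙ proj
    ; section = section ⊙ Along.section
    ; retract = retract′
    ; kernel  = kernel′
    }
    where
    open SpanQuotient q
    w : Vector (suc m)
    w = proj ⊛ v zero
    w⁻¹ : Carrier
    w⁻¹ = proj₁ (inverse (w p) wp≉0)
    module Along = ProjectAlong w p w⁻¹ (proj₂ (inverse (w p) wp≉0))

    retract′ : ∀ y j → ((Along.proj ⊙ proj) ⊛ (section ⊙ Along.section) ⊛ y) j ≈ y j
    retract′ y j = begin
      ((Along.proj ⊙ proj) ⊛ (section ⊙ Along.section) ⊛ y) j   ≈⟨ ⊛-assoc Along.proj proj _ j ⟩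
      (Along.proj ⊛ proj ⊛ (section ⊙ Along.section) ⊛ y) j     ≈⟨ ⊛-cong Along.proj (⊛-cong proj (⊛-assoc section Along.section y)) j ⟩
      (Along.proj ⊛ proj ⊛ section ⊛ Along.section ⊛ y) j       ≈⟨ ⊛-cong Along.proj (retract (Along.section ⊛ y)) j ⟩
      (Along.proj ⊛ Along.section ⊛ y) j                        ≈⟨ Along.retract y j ⟩
      y j                                                       ∎

    -- x ↦ proj x lands in the line through w, so subtracting the matching
    -- multiple of v₀ lands in the kernel of proj, i.e. in the span of the rest.
    kernel′ : ∀ x → (∀ j → ((Along.proj ⊙ proj) ⊛ x) j ≈ 0#) → InSpan v x
    kernel′ x x≈0 = (λ₀ ∷ β) , λ u →
      trans (sym (a-b+b≈a (x u) (λ₀ * v zero u))) (trans (+-congʳ (x′≈βv u)) (+-comm _ _))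
      where
      λ₀ : Carrier
      λ₀ = (proj ⊛ x) p * w⁻¹
      proj-x : ∀ j → (proj ⊛ x) j ≈ λ₀ * w j
      proj-x = Along.kernel (proj ⊛ x) (λ j → trans (sym (⊛-assoc Along.proj proj x j)) (x≈0 j))
      proj-x′ : ∀ j → (proj ⊛ (λ u → x u - λ₀ * v zero u)) j ≈ 0#
      proj-x′ j = trans (⊛-sub proj x (λ u → λ₀ * v zero u) j)
                        (x≈y⇒x∙y⁻¹≈ε (trans (proj-x j) (sym (⊛-scale proj λ₀ (v zero) j))))
      β : Vector k
      β = proj₁ (kernel _ proj-x′)
      x′≈βv : ∀ u → x u - λ₀ * v zero u ≈ sum (λ a → β a * v (suc a) u)
      x′≈βv = proj₂ (kernel _ proj-x′)

  -- Every independent family admits a quotient (not-not, since locating a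
  -- nonzero entry is not decidable over an abstract field).
  quotient-exists : ∀ {n k} (v : Fin k → Vector n) → Independent v → ¬ ¬ Σ ℕ (SpanQuotient v)
  quotient-exists {k = zero}  v ind ¬q = ¬q (_ , identity-quotient v)
  quotient-exists {k = suc k} v ind ¬q =
    quotient-exists (v ∘ suc) (independent-tail {v = v} ind) λ (m , q) →
      zero-or-nonzero (SpanQuotient.proj q ⊛ v zero) λ
        { (inj₁ w≈0)         → head∉span-tail {v = v} ind (SpanQuotient.kernel q (v zero) w≈0)
        ; (inj₂ (p , wp≉0)) → ¬q (_ , extend-quotient {v = v} q p wp≉0)
        }

  independent⇒≤ : ∀ {n k} (v : Fin k → Vector n) → Independent v → k ≤ n
  independent⇒≤ {n} {k} v ind = decidable-stable (k ℕ.≤? n) (¬¬-map bound (quotient-exists v ind))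
    where
    bound : Σ ℕ (SpanQuotient v) → k ≤ n
    bound (m , q) = ≡.subst (k ≤_) (SpanQuotient.m+k≡n q) (ℕP.m≤n+m k m)

  lin : ∀ {t} → Vector t → Vector t → Carrier
  lin ℓ z = sum (λ i → ℓ i * z i)

  column : ∀ {m n} → Mat m n → Fin n → Vector m
  column M u i = M i u

  bilinear : ∀ {m} → Mat m m → Vector m → Vector m → Carrier
  bilinear M x y = lin (λ j → lin (column M j) x) y

  ⊛-unit : ∀ {m n} (M : Mat m n) u i → (M ⊛ (λ u′ → δ u′ u)) i ≈ M i u
  ⊛-unit M u i = trans (sum-single (λ u′ → M i u′ * δ u′ u) u off)
                       (trans (*-congˡ (reflexive (δ-diag u))) (*-identityʳ (M i u)))
    where
    off : ∀ u′ → u′ ≢ u → M i u′ * δ u′ u ≈ 0#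
    off u′ u′≢u = trans (*-congˡ (reflexive (δ-off u′≢u))) (zeroʳ (M i u′))

  -- This is where the rank of G (at most m) enters.
  module GramFactorisation {n m} (G : Mat n n) (P : Mat m n) (S : Mat n m)
                           (G-sym : ∀ w u → G w u ≈ G u w)
                           (retract : ∀ y j → (P ⊛ S ⊛ y) j ≈ y j)
                           (G-kills : ∀ x → (∀ j → (P ⊛ x) j ≈ 0#) → ∀ w → (G ⊛ x) w ≈ 0#) where

    M : Mat m m
    M i j = sum (λ x → (G ⊙ S) x i * S x j)

    -- G only sees the image of x in the quotient: x - S P x lies in ker P.
    G-factors : ∀ x w → (G ⊛ x) w ≈ (G ⊛ S ⊛ P ⊛ x) w
    G-factors x w = x∙y⁻¹≈ε⇒x≈y _ _ (trans (sym (⊛-sub G x (S ⊛ P ⊛ x) w)) (G-kills _ in-kernel w))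
      where
      in-kernel : ∀ j → (P ⊛ (λ u → x u - (S ⊛ P ⊛ x) u)) j ≈ 0#
      in-kernel j = trans (⊛-sub P x (S ⊛ P ⊛ x) j) (x≈y⇒x∙y⁻¹≈ε (sym (retract (P ⊛ x) j)))

    G-entry : ∀ w u → G w u ≈ ((G ⊙ S) ⊛ column P u) w
    G-entry w u = begin
      G w u                                ≈⟨ ⊛-unit G u w ⟨
      (G ⊛ e) w                            ≈⟨ G-factors e w ⟩
      (G ⊛ S ⊛ P ⊛ e) w                    ≈⟨ ⊛-assoc G S (P ⊛ e) w ⟨
      ((G ⊙ S) ⊛ P ⊛ e) w                  ≈⟨ ⊛-cong (G ⊙ S) (⊛-unit P u) w ⟩
      ((G ⊙ S) ⊛ column P u) w             ∎
      where
      e : Vector n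
      e u′ = δ u′ u

    -- By symmetry, the rows of G S are themselves determined by the columns of P.
    GS-entry : ∀ w j → (G ⊙ S) w j ≈ lin (column M j) (column P w)
    GS-entry w j = begin
      sum (λ x → G w x * S x j)
        ≈⟨ sum-cong-≋ (λ x → *-congʳ (trans (G-sym w x) (G-entry x w))) ⟩
      sum (λ x → sum (λ i → (G ⊙ S) x i * P i w) * S x j)
        ≈⟨ sum-cong-≋ (λ x → *-distribʳ-sum (S x j) (λ i → (G ⊙ S) x i * P i w)) ⟩
      sum (λ x → sum (λ i → (G ⊙ S) x i * P i w * S x j))
        ≈⟨ ∑-comm (λ x i → (G ⊙ S) x i * P i w * S x j) ⟩
      sum (λ i → sum (λ x → (G ⊙ S) x i * P i w * S x j))
        ≈⟨ sum-cong-≋ (λ i → sum-cong-≋ (λ x → xy∙z≈xz∙y ((G ⊙ S) x i) (P i w) (S x j))) ⟩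
      sum (λ i → sum (λ x → (G ⊙ S) x i * S x j * P i w))
        ≈⟨ sum-cong-≋ (λ i → *-distribʳ-sum (P i w) (λ x → (G ⊙ S) x i * S x j)) ⟨
      sum (λ i → M i j * P i w)
        ∎

    gram : ∀ w u → G w u ≈ bilinear M (column P w) (column P u)
    gram w u = trans (G-entry w u) (sum-cong-≋ (λ j → *-congʳ (GS-entry w j)))

  -- Homogeneous polynomials of degree d in t variables z₀ … z_{t-1}, in the
  -- normal form p(z) = p₁(z₁, …) + z₀ · p₂(z), where p₁ (degree d) does not
  -- involve z₀ and p₂ has degree d - 1.
  data Hom : ℕ → ℕ → Set c where
    const : ∀ {t} → Carrier → Hom zero t
    none  : ∀ {d} → Hom (suc d) zero
    _+z₀*_ : ∀ {d t} → Hom (suc d) t → Hom d (suc t) → Hom (suc d) (suc t)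

  eval : ∀ {d t} → Hom d t → Vector t → Carrier
  eval (const a)  z = a
  eval none       z = 0#
  eval (p +z₀* q) z = eval p (z ∘ suc) + z zero * eval q z

  coefficients : ∀ {d t} → Hom d t → Vector (monomials d t)
  coefficients (const a)  = λ _ → a
  coefficients none       = λ ()
  coefficients (p +z₀* q) = coefficients p ++ coefficients q

  monomial : ∀ d t → Vector t → Vector (monomials d t)
  monomial zero    t       z = λ _ → 1#
  monomial (suc d) zero    z = λ ()
  monomial (suc d) (suc t) z = monomial (suc d) t (z ∘ suc) ++ (λ j → z zero * monomial d (suc t) z j)

  sum-split : ∀ a b (h : Vector (a ℕ.+ b)) → sum h ≈ sum (λ i → h (i ↑ˡ b)) + sum (λ j → h (a ↑ʳ j))
  sum-split zero    b h = sym (+-identityˡ (sum h))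
  sum-split (suc a) b h = trans (+-congˡ (sum-split a b (h ∘ suc))) (sym (+-assoc _ _ _))

  lin-++ : ∀ {a b} (ℓ x : Vector a) (ℓ′ x′ : Vector b) → lin (ℓ ++ ℓ′) (x ++ x′) ≈ lin ℓ x + lin ℓ′ x′
  lin-++ {a} {b} ℓ x ℓ′ x′ = trans (sum-split a b _) (+-cong
    (reflexive (sum-cong-≗ (λ i → ≡.cong₂ _*_ (lookup-++ˡ ℓ ℓ′ i) (lookup-++ˡ x x′ i))))
    (reflexive (sum-cong-≗ (λ j → ≡.cong₂ _*_ (lookup-++ʳ ℓ ℓ′ j) (lookup-++ʳ x x′ j)))))

  lin-scaleʳ : ∀ {t} a (ℓ z : Vector t) → a * lin ℓ z ≈ lin ℓ (λ i → a * z i)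
  lin-scaleʳ a ℓ z = trans (*-distribˡ-sum a (λ i → ℓ i * z i)) (sum-cong-≋ (λ i → x∙yz≈y∙xz a (ℓ i) (z i)))

  eval-coefficients : ∀ {d t} (p : Hom d t) z → eval p z ≈ lin (coefficients p) (monomial d t z)
  eval-coefficients (const a) z = sym (trans (+-identityʳ (a * 1#)) (*-identityʳ a))
  eval-coefficients none      z = refl
  eval-coefficients {suc d} {suc t} (p +z₀* q) z = begin
    eval p (z ∘ suc) + z zero * eval q z
      ≈⟨ +-cong (eval-coefficients p (z ∘ suc)) (*-congˡ (eval-coefficients q z)) ⟩
    lin (coefficients p) (monomial (suc d) t (z ∘ suc)) + z zero * lin (coefficients q) (monomial d (suc t) z)
      ≈⟨ +-congˡ (lin-scaleʳ (z zero) (coefficients q) (monomial d (suc t) z)) ⟩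
    lin (coefficients p) (monomial (suc d) t (z ∘ suc)) + lin (coefficients q) z₀-part
      ≈⟨ lin-++ (coefficients p) (monomial (suc d) t (z ∘ suc)) (coefficients q) z₀-part ⟨
    lin (coefficients (p +z₀* q)) (monomial (suc d) (suc t) z) ∎
    where
    z₀-part : Vector (monomials d (suc t))
    z₀-part j = z zero * monomial d (suc t) z j

  zero-hom : ∀ d t → Hom d t
  zero-hom zero    t       = const 0#
  zero-hom (suc d) zero    = none
  zero-hom (suc d) (suc t) = zero-hom (suc d) t +z₀* zero-hom d (suc t)

  eval-zero : ∀ d t z → eval (zero-hom d t) z ≈ 0#
  eval-zero zero    t       z = refl
  eval-zero (suc d) zero    z = refl
  eval-zero (suc d) (suc t) z =
    trans (+-cong (eval-zero (suc d) t (z ∘ suc)) (trans (*-congˡ (eval-zero d (suc t) z)) (zeroʳ (z zero)))) (+-identityʳ 0#)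

  infixl 6 _⊕_
  _⊕_ : ∀ {d t} → Hom d t → Hom d t → Hom d t
  const a    ⊕ const b      = const (a + b)
  none       ⊕ none         = none
  (p +z₀* q) ⊕ (p′ +z₀* q′) = (p ⊕ p′) +z₀* (q ⊕ q′)

  eval-⊕ : ∀ {d t} (p q : Hom d t) z → eval (p ⊕ q) z ≈ eval p z + eval q z
  eval-⊕ (const a)  (const b)    z = refl
  eval-⊕ none       none         z = sym (+-identityʳ 0#)
  eval-⊕ (p +z₀* q) (p′ +z₀* q′) z = begin
    eval (p ⊕ p′) (z ∘ suc) + z zero * eval (q ⊕ q′) z
      ≈⟨ +-cong (eval-⊕ p p′ (z ∘ suc)) (trans (*-congˡ (eval-⊕ q q′ z)) (distribˡ (z zero) _ _)) ⟩
    (eval p (z ∘ suc) + eval p′ (z ∘ suc)) + (z zero * eval q z + z zero * eval q′ z)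
      ≈⟨ +-interchange _ _ _ _ ⟩
    (eval p (z ∘ suc) + z zero * eval q z) + (eval p′ (z ∘ suc) + z zero * eval q′ z) ∎

  scale : ∀ {d t} → Carrier → Hom d t → Hom d t
  scale a (const b)  = const (a * b)
  scale a none       = none
  scale a (p +z₀* q) = scale a p +z₀* scale a q

  eval-scale : ∀ {d t} a (p : Hom d t) z → eval (scale a p) z ≈ a * eval p z
  eval-scale a (const b)  z = refl
  eval-scale a none       z = sym (zeroʳ a)
  eval-scale a (p +z₀* q) z = begin
    eval (scale a p) (z ∘ suc) + z zero * eval (scale a q) z
      ≈⟨ +-cong (eval-scale a p (z ∘ suc)) (trans (*-congˡ (eval-scale a q z)) (x∙yz≈y∙xz (z zero) a (eval q z))) ⟩
    a * eval p (z ∘ suc) + a * (z zero * eval q z)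
      ≈⟨ distribˡ a _ _ ⟨
    a * eval (p +z₀* q) z ∎

  hom-sum : ∀ {d t k} → (Fin k → Hom d t) → Hom d t
  hom-sum {d} {t} {zero}  f = zero-hom d t
  hom-sum {d} {t} {suc k} f = f zero ⊕ hom-sum (f ∘ suc)

  eval-hom-sum : ∀ {d t k} (f : Fin k → Hom d t) z → eval (hom-sum f) z ≈ sum (λ i → eval (f i) z)
  eval-hom-sum {d} {t} {zero}  f z = eval-zero d t z
  eval-hom-sum {d} {t} {suc k} f z = trans (eval-⊕ (f zero) (hom-sum (f ∘ suc)) z) (+-congˡ (eval-hom-sum (f ∘ suc) z))

  embed : ∀ {d t} → Hom d t → Hom d (suc t)
  embed {zero}      (const a) = const a
  embed {suc d} {t} p         = p +z₀* zero-hom d (suc t)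

  eval-embed : ∀ {d t} (p : Hom d t) z → eval (embed p) z ≈ eval p (z ∘ suc)
  eval-embed {zero} (const a) z = refl
  eval-embed {suc d} {t} p z = trans (+-congˡ (trans (*-congˡ (eval-zero d (suc t) z)) (zeroʳ (z zero)))) (+-identityʳ _)

  times : ∀ {d t} → Vector t → Hom d t → Hom (suc d) t
  times {t = zero}  ℓ p          = none
  times {t = suc t} ℓ (const a)  = times (ℓ ∘ suc) (const a) +z₀* const (ℓ zero * a)
  times {t = suc t} ℓ (p +z₀* q) = times (ℓ ∘ suc) p +z₀* (scale (ℓ zero) (embed p) ⊕ times ℓ q)

  eval-times : ∀ {d t} (ℓ : Vector t) (p : Hom d t) z → eval (times ℓ p) z ≈ lin ℓ z * eval p z
  eval-times {t = zero}  ℓ p          z = sym (zeroˡ (eval p z))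
  eval-times {t = suc t} ℓ (const a)  z = begin
    eval (times (ℓ ∘ suc) (const a)) (z ∘ suc) + z zero * (ℓ zero * a)
      ≈⟨ +-cong (eval-times (ℓ ∘ suc) (const a) (z ∘ suc)) (x∙yz≈yx∙z (z zero) (ℓ zero) a) ⟩
    lin (ℓ ∘ suc) (z ∘ suc) * a + ℓ zero * z zero * a
      ≈⟨ +-comm _ _ ⟩
    ℓ zero * z zero * a + lin (ℓ ∘ suc) (z ∘ suc) * a
      ≈⟨ distribʳ a _ _ ⟨
    lin ℓ z * a ∎
  eval-times {t = suc t} ℓ (p +z₀* q) z = begin
    eval (times (ℓ ∘ suc) p) (z ∘ suc) + z zero * eval (scale (ℓ zero) (embed p) ⊕ times ℓ q) z
      ≈⟨ +-cong (eval-times (ℓ ∘ suc) p (z ∘ suc))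
                (*-congˡ (trans (eval-⊕ (scale (ℓ zero) (embed p)) (times ℓ q) z)
                                (+-cong (trans (eval-scale (ℓ zero) (embed p) z) (*-congˡ (eval-embed p z)))
                                        (eval-times ℓ q z)))) ⟩
    L′ * P + b * (a * P + (a * b + L′) * Q)
      ≈⟨ solve 5 (λ L′ P a b Q → L′ :* P :+ b :* (a :* P :+ (a :* b :+ L′) :* Q) := (a :* b :+ L′) :* (P :+ b :* Q))
                 refl L′ P a b Q ⟩
    (a * b + L′) * (P + b * Q) ∎
    where
    L′ = lin (ℓ ∘ suc) (z ∘ suc)
    P  = eval p (z ∘ suc)
    Q  = eval q z
    a  = ℓ zero
    b  = z zero

  separated⇒independent : ∀ {d t n} (f : Fin n → Hom d t) (z : Fin n → Vector t) →
                          (∀ w u → w ≢ u → eval (f w) (z u) ≈ 0#) → (∀ u → ¬ eval (f u) (z u) ≈ 0#) →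
                          Independent (λ w → coefficients (f w))
  separated⇒independent {d} {t} f z off own a rel u = cancelʳ (own u) (begin
    a u * eval (f u) (z u)                       ≈⟨ sum-single (λ w → a w * eval (f w) (z u)) u others ⟨
    sum (λ w → a w * eval (f w) (z u))           ≈⟨ sum-cong-≋ (λ w → trans (*-congˡ (eval-coefficients (f w) (z u)))
                                                                            (*-distribˡ-sum (a w) (λ i → coef w i * mon i))) ⟩
    sum (λ w → sum (λ i → a w * (coef w i * mon i))) ≈⟨ ∑-comm (λ w i → a w * (coef w i * mon i)) ⟩
    sum (λ i → sum (λ w → a w * (coef w i * mon i))) ≈⟨ sum-cong-≋ (λ i → trans (sum-cong-≋ (λ w → sym (*-assoc (a w) (coef w i) (mon i))))
                                                           (sym (*-distribʳ-sum (mon i) (λ w → a w * coef w i)))) ⟩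
    sum (λ i → sum (λ w → a w * coef w i) * mon i)  ≈⟨ sum-zero (λ i → trans (*-congʳ (rel i)) (zeroˡ (mon i))) ⟩
    0#                                           ∎)
    where
    coef : ∀ w → Vector (monomials d t)
    coef w = coefficients (f w)
    mon : Vector (monomials d t)
    mon = monomial d t (z u)
    others : ∀ w → w ≢ u → a w * eval (f w) (z u) ≈ 0#
    others w w≢u = trans (*-congˡ (off w u w≢u)) (zeroʳ (a w))

  linear : ∀ {t} → Vector t → Hom 1 t
  linear ℓ = times ℓ (const 1#)

  eval-linear : ∀ {t} (ℓ z : Vector t) → eval (linear ℓ) z ≈ lin ℓ z
  eval-linear ℓ z = trans (eval-times ℓ (const 1#) z) (*-identityʳ (lin ℓ z))

  quadratic : ∀ {m} → Mat m m → Hom 2 m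
  quadratic M = hom-sum (λ j → times (column M j) (linear (δ j)))

  eval-quadratic : ∀ {m} (M : Mat m m) z → eval (quadratic M) z ≈ bilinear M z z
  eval-quadratic M z = trans (eval-hom-sum (λ j → times (column M j) (linear (δ j))) z)
    (sum-cong-≋ (λ j → trans (eval-times (column M j) (linear (δ j)) z) (*-congˡ (trans (eval-linear (δ j) z) (⊛-δ z j)))))

  module _ {m} (M : Mat m m) (μ : Carrier) (x : Vector m) where
    private
      ℓ : Vector m
      ℓ j = lin (column M j) x

      square : Hom 2 m
      square = times ℓ (linear ℓ)

      factor : Hom 2 m
      factor = scale μ square ⊕ scale (- 1#) (quadratic M)

    gram-cubic : Hom 3 m
    gram-cubic = times ℓ factor

    eval-gram-cubic : ∀ z → eval gram-cubic z ≈
                            bilinear M x z * (μ * (bilinear M x z * bilinear M x z) - bilinear M z z)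
    eval-gram-cubic z = trans (eval-times ℓ factor z) (*-congˡ (trans (eval-⊕ (scale μ square) (scale (- 1#) (quadratic M)) z)
      (+-cong (trans (eval-scale μ square z) (*-congˡ (trans (eval-times ℓ (linear ℓ) z) (*-congˡ (eval-linear ℓ z)))))
              (trans (eval-scale (- 1#) (quadratic M) z) (trans (-1*x≈-x _) (-‿cong (eval-quadratic M z)))))))

  difference-of-squares : ∀ a → (a - 1#) * (a + 1#) ≈ a * a - 1#
  difference-of-squares a = begin
    (a - 1#) * (a + 1#)            ≈⟨ distribˡ (a - 1#) a 1# ⟩
    (a - 1#) * a + (a - 1#) * 1#   ≈⟨ +-cong ([y-z]x≈yx-zx a a 1#) (*-identityʳ (a - 1#)) ⟩
    (a * a - 1# * a) + (a - 1#)    ≈⟨ +-congʳ (+-congˡ (-‿cong (*-identityˡ a))) ⟩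
    (a * a - a) + (a - 1#)         ≈⟨ +-assoc (a * a) (- a) (a - 1#) ⟩
    a * a + (- a + (a - 1#))       ≈⟨ +-congˡ (+-assoc (- a) a (- 1#)) ⟨
    a * a + ((- a + a) - 1#)       ≈⟨ +-congˡ (+-congʳ (-‿inverseˡ a)) ⟩
    a * a + (0# - 1#)              ≈⟨ +-congˡ (+-identityˡ (- 1#)) ⟩
    a * a - 1#                     ∎

  cube-nonzero : ∀ {μ} → ¬ μ ≈ 0# → ¬ μ ≈ 1# → ¬ μ ≈ - 1# → ¬ μ * (μ * (μ * μ) - μ) ≈ 0#
  cube-nonzero {μ} μ≉0 μ≉1 μ≉-1 = *-nonzero μ≉0 λ cube≈0 →
    *-nonzero μ≉0 (*-nonzero μ-1≉0 μ+1≉0) (trans (sym factorised) cube≈0)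
    where
    μ-1≉0 : ¬ μ - 1# ≈ 0#
    μ-1≉0 e = μ≉1 (x∙y⁻¹≈ε⇒x≈y μ 1# e)
    μ+1≉0 : ¬ μ + 1# ≈ 0#
    μ+1≉0 e = μ≉-1 (x∙y⁻¹≈ε⇒x≈y μ (- 1#) (trans (+-congˡ (-‿involutive 1#)) e))
    factorised : μ * (μ * μ) - μ ≈ μ * ((μ - 1#) * (μ + 1#))
    factorised = begin
      μ * (μ * μ) - μ         ≈⟨ +-congˡ (-‿cong (*-identityʳ μ)) ⟨
      μ * (μ * μ) - μ * 1#    ≈⟨ x[y-z]≈xy-xz μ (μ * μ) 1# ⟨
      μ * (μ * μ - 1#)        ≈⟨ *-congˡ (difference-of-squares μ) ⟨
      μ * ((μ - 1#) * (μ + 1#)) ∎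

  cube-fixed⇒vanishes : ∀ {g} μ → g * (g * g) ≈ g → g * (μ * (g * g) - μ) ≈ 0#
  cube-fixed⇒vanishes {g} μ g³≈g = trans (x[y-z]≈xy-xz g (μ * (g * g)) μ) (x≈y⇒x∙y⁻¹≈ε (begin
    g * (μ * (g * g))   ≈⟨ x∙yz≈y∙xz g μ (g * g) ⟩
    μ * (g * (g * g))   ≈⟨ *-congˡ g³≈g ⟩
    μ * g               ≈⟨ *-comm μ g ⟩
    g * μ               ∎))

  cube-fixed-neg : ∀ {g} → g * (g * g) ≈ g → - g * (- g * - g) ≈ - g
  cube-fixed-neg {g} g³≈g = begin
    - g * (- g * - g)   ≈⟨ *-congˡ (trans (sym (-‿distribˡ-* g (- g))) (-‿cong (sym (-‿distribʳ-* g g)))) ⟩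
    - g * - - (g * g)   ≈⟨ *-congˡ (-‿involutive (g * g)) ⟩
    - g * (g * g)       ≈⟨ -‿distribˡ-* g (g * g) ⟨
    - (g * (g * g))     ≈⟨ -‿cong g³≈g ⟩
    - g                 ∎

  module Shifted {n} (Σg : SignedGraph n) (μ : Carrier) where
    open SignedGraph Σg

    G : Mat n n
    G w u = μ * δ w u - adjacency Σg w u

    G-sym : ∀ w u → G w u ≈ G u w
    G-sym w u = reflexive (≡.cong₂ (λ d e → μ * d - signValue e) (δ-sym w u) (symmetric w u))

    G-diag : ∀ u → G u u ≈ μ
    G-diag u = begin
      μ * δ u u - signValue (edge u u)   ≡⟨ ≡.cong₂ (λ d e → μ * d - signValue e) (δ-diag u) (loopless u) ⟩
      μ * 1# - 0#                        ≈⟨ +-cong (*-identityʳ μ) -0#≈0# ⟩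
      μ + 0#                             ≈⟨ +-identityʳ μ ⟩
      μ                                  ∎

    -- Off the diagonal the entries are 0 or ±1, all solutions of g³ = g.
    sign-cube : ∀ e → signValue e * (signValue e * signValue e) ≈ signValue e
    sign-cube absent   = zeroˡ _
    sign-cube positive = trans (*-identityˡ _) (*-identityˡ 1#)
    sign-cube negative = cube-fixed-neg (sign-cube positive)

    G-off : ∀ {w u} → w ≢ u → G w u * (G w u * G w u) ≈ G w u
    G-off {w} {u} w≢u = trans (*-cong G≈-s (*-cong G≈-s G≈-s)) (trans (cube-fixed-neg (sign-cube (edge w u))) (sym G≈-s))
      where
      G≈-s : G w u ≈ - signValue (edge w u)
      G≈-s = trans (+-congʳ (trans (*-congˡ (reflexive (δ-off w≢u))) (zeroʳ μ))) (+-identityˡ _)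

    eigenvector⇒kernel : ∀ x → InEigenspace (adjacency Σg) μ x → ∀ w → (G ⊛ x) w ≈ 0#
    eigenvector⇒kernel x Ax≈μx w = begin
      (G ⊛ x) w                                 ≈⟨ ⊛-difference (λ w u → μ * δ w u) (adjacency Σg) x w ⟩
      sum (λ u → μ * δ w u * x u) - (adjacency Σg ⊛ x) w ≈⟨ +-cong (scaled-δ μ x w) (-‿cong Ax≈μx′) ⟩
      μ * x w - μ * x w                         ≈⟨ -‿inverseʳ (μ * x w) ⟩
      0#                                        ∎
      where
      Ax≈μx′ : (adjacency Σg ⊛ x) w ≈ μ * x w
      Ax≈μx′ = ≡.subst (_≈ μ * x w) (∑≡sum (λ u → adjacency Σg w u * x u)) (Ax≈μx w)

  -- Given k independent μ-eigenvectors and the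
  -- quotient by their span (dimension m), μI − A is the Gram matrix of n
  -- points of F^m; the n attached cubics are separated by these points, so
  -- n is at most the number of cubic monomials in m variables.
  vertex-bound : ∀ {n k m} (Σg : SignedGraph n) (μ : Carrier) → ¬ μ ≈ 0# → ¬ μ ≈ 1# → ¬ μ ≈ - 1# →
                 (v : Fin k → Vector n) → (∀ a → InEigenspace (adjacency Σg) μ (v a)) →
                 SpanQuotient v m → n ≤ monomials 3 m
  vertex-bound Σg μ μ≉0 μ≉1 μ≉-1 v eigen q =
    independent⇒≤ (λ w → coefficients (cubic w)) (separated⇒independent cubic point off own)
    where
    open Shifted Σg μ
    open SpanQuotient q

    -- ker P lies in the span of the eigenvectors, hence in ker G.
    G-kills : ∀ x → (∀ j → (proj ⊛ x) j ≈ 0#) → ∀ w → (G ⊛ x) w ≈ 0#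
    G-kills x x≈0 w with kernel x x≈0
    ... | l , x≈lv = trans (⊛-cong G x≈lv w) (trans (⊛-combination G l v w)
                       (sum-zero (λ a → trans (*-congˡ (eigenvector⇒kernel (v a) (eigen a) w)) (zeroʳ (l a)))))

    open GramFactorisation G proj section G-sym retract G-kills

    point : Fin _ → Vector _
    point = column proj

    cubic : Fin _ → Hom 3 _
    cubic w = gram-cubic M μ (point w)

    cubic-at : ∀ w u → eval (cubic w) (point u) ≈ G w u * (μ * (G w u * G w u) - μ)
    cubic-at w u = trans (eval-gram-cubic M μ (point w) (point u))
      (sym (*-cong (gram w u) (+-cong (*-congˡ (*-cong (gram w u) (gram w u))) (-‿cong (trans (sym (G-diag u)) (gram u u))))))

    off : ∀ w u → w ≢ u → eval (cubic w) (point u) ≈ 0#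
    off w u w≢u = trans (cubic-at w u) (cube-fixed⇒vanishes μ (G-off w≢u))

    own : ∀ u → ¬ eval (cubic u) (point u) ≈ 0#
    own u e = cube-nonzero μ≉0 μ≉1 μ≉-1 (trans (sym μ-instance) (trans (sym (cubic-at u u)) e))
      where
      μ-instance : G u u * (μ * (G u u * G u u) - μ) ≈ μ * (μ * (μ * μ) - μ)
      μ-instance = *-cong (G-diag u) (+-congʳ (*-congˡ (*-cong (G-diag u) (G-diag u))))

theorem3p3 : ∀ {c ℓ₁ ℓ₂ : Level} (F : OrderedField c ℓ₁ ℓ₂) →
    let open LinearAlgebra F
    in ∀ (n : ℕ) (Σg : SignedGraph n) (μ : Carrier) (k : ℕ) →
    IsEigenvalueWithMultiplicity Σg μ k →
    ¬ (μ ≈ 0#) → ¬ (μ ≈ 1#) → ¬ (μ ≈ - 1#) →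
    n ≤ suc (suc (n ∸ k)) C 3
theorem3p3 F n Σg μ k (_ , (v , li , eigen) , _) μ≉0 μ≉1 μ≉-1 =
  decidable-stable (n ℕ.≤? _) (¬¬-map bound (quotient-exists F v (independent F li)))
  where
  bound : Σ ℕ (SpanQuotient F v) → n ≤ suc (suc (n ∸ k)) C 3
  bound (m , q) = ≡.subst (λ m → n ≤ suc (suc m) C 3) m≡n∸k
                    (≡.subst (n ≤_) (cubic-monomials m) (vertex-bound F Σg μ μ≉0 μ≉1 μ≉-1 v eigen q))
    where
    m≡n∸k : m ≡ n ∸ k
    m≡n∸k = ≡.trans (≡.sym (ℕP.m+n∸n≡m m k)) (≡.cong (_∸ k) (SpanQuotient.m+k≡n q))
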